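{- For every $v\in\{a,b\}^*$, $h(v)=\delta(v)$.
   Context: A word is constant if it is a power of one letter (including $\varepsilon$). For non-constant $u\in\{a,b\}^*$, ${}_+u$ is the longest suffix of $u$ immediately preceded by the letter different from the first letter of $u$. Height: $v_{(1)}=v$, $v_{(n+1)}={}_+(v_{(n)})$ while $v_{(n)}$ is non-constant; $h(v)$ is the index $h$ with $v_{(h)}$ constant. The function $\delta$: $\delta(\varepsilon)=1$; for nonempty $v$, write uniquely $v=x_0^{\alpha_0}\cdots x_n^{\alpha_n}$ with letters $x_i$, $\alpha_i\ge1$, $x_{i+1}\ne x_i$, and define $\delta_i(v)\in\{0,1\}$ for $0\le i\le n$ by: $\delta_0(v)=\delta_n(v)=1$; for $0<i<n$, $\delta_i(v)=1$ if $\alpha_i>1$; if $\alpha_i=1$ and $\alpha_{i-1}>1$ then $\delta_i(v)=0$; if $\alpha_i=\alpha_{i-1}=1$ then $\delta_i(v)=1$ iff $\delta_{i-1}(v)=0$. Then $\delta(v)=\sum_{i=0}^n\delta_i(v)$. -}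

module Defs where

open import Data.Nat using (ℕ; zero; suc; _+_; _≤ᵇ_)
open import Data.Bool using (Bool; true; false; if_then_else_; _∧_; not)
open import Data.List using (List; []; _∷_; length)
open import Data.Nat.ListAction using (sum)

data Letter : Set where
  a b : Letter

_==_ : Letter → Letter → Bool
a == a = true
b == b = true
a == b = false
b == a = false

other : Letter → Letter
other a = b
other b = a

Word : Set
Word = List Letter

allEq : Letter → Word → Bool
allEq x []      = true
allEq x (y ∷ w) = (x == y) ∧ allEq x w

isConstant : Word → Bool
isConstant []      = true
isConstant (x ∷ w) = allEq x w

-- ₊u : for non-constant u with first letter x, the longest suffix of u
-- immediately preceded by the letter other x, i.e. the suffix following
-- the FIRST occurrence of other x in u.  (Value on constant words is
-- irrelevant; it is never used there.)
afterFirst : Letter → Word → Word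
afterFirst y []      = []
afterFirst y (z ∷ w) = if z == y then w else afterFirst y w

plus : Word → Word
plus []      = []
plus (x ∷ w) = afterFirst (other x) w

-- height: v₍₁₎ = v, v₍ₙ₊₁₎ = ₊(v₍ₙ₎) while v₍ₙ₎ non-constant;
-- h(v) is the index h with v₍ₕ₎ constant.  Computed with fuel
-- (length v suffices, as ₊ strictly shortens non-constant words).
heightF : ℕ → Word → ℕ
heightF zero     v = 1
heightF (suc f) v = if isConstant v then 1 else suc (heightF f (plus v))

height : Word → ℕ
height v = heightF (length v) v

-- run-length exponents: v = x₀^α₀ ⋯ xₙ^αₙ  ↦  α₀ ∷ ⋯ ∷ αₙ ∷ []
runsFrom : Letter → ℕ → Word → List ℕ
runsFrom x k []      = k ∷ []
runsFrom x k (y ∷ w) = if x == y then runsFrom x (suc k) w else k ∷ runsFrom y 1 w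

exponents : Word → List ℕ
exponents []      = []
exponents (x ∷ w) = runsFrom x 1 w

-- δᵢ for i ≥ 1, given α_{i-1} and δ_{i-1}; the last index gets 1.
gt1 : ℕ → Bool
gt1 n = 2 ≤ᵇ n

deltaGo : ℕ → ℕ → List ℕ → List ℕ
deltaGo pα pδ []              = []
deltaGo pα pδ (α ∷ [])        = 1 ∷ []
deltaGo pα pδ (α ∷ r@(_ ∷ _)) = d ∷ deltaGo α d r
  where
    d : ℕ
    d = if gt1 α then 1
        else (if gt1 pα then 0
        else (if pδ Data.Nat.≡ᵇ 0 then 1 else 0))

deltas : List ℕ → List ℕ
deltas []      = []
deltas (α ∷ r) = 1 ∷ deltaGo α 1 r

δ : Word → ℕ
δ []        = 1
δ v@(_ ∷ _) = sum (deltas (exponents v))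

-- Both sides obey the same recursion. A constant word has δ = 1. A
-- non-constant word is v = x^k y u with y ≠ x and ₊v = u, and deleting the
-- prefix x^k y lowers the δ-sum by exactly one: if u begins with y, the
-- y-run (δ₁ = 1) just becomes the first run, one letter shorter; if u begins
-- with x, the single y has δ₁ = 0 and the next run already has δ = 1. In
-- both cases the later δᵢ are unchanged, so δ(v) = 1 + δ(₊v), which is the
-- recursion defining h.
module Submission where

open import Defs
open import Relation.Binary.PropositionalEquality using (_≡_; refl; cong; sym; trans)
open import Data.Nat using (ℕ; zero; suc; _≤_; z≤n; s≤s)
open import Data.Nat.Properties using (≤-refl; ≤-trans; n≤1+n)
open import Data.Bool using (true; false)
open import Data.List using (List; []; _∷_; length)
open import Data.Nat.ListAction using (sum)

deltaSum : List ℕ → ℕ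
deltaSum αs = sum (deltas αs)

deltaGo-after-one : ∀ p q αs → deltaGo p 1 αs ≡ deltaGo q 1 αs
deltaGo-after-one p q []                = refl
deltaGo-after-one p q (α ∷ [])          = refl
deltaGo-after-one p q (α ∷ αs@(_ ∷ _)) with gt1 α | gt1 p | gt1 q
... | true  | _     | _     = refl
... | false | true  | true  = refl
... | false | true  | false = refl
... | false | false | true  = refl
... | false | false | false = refl

deltaSum-∷-long : ∀ k c αs →
  deltaSum (k ∷ suc (suc c) ∷ αs) ≡ suc (deltaSum (suc c ∷ αs))
deltaSum-∷-long k c []          = refl
deltaSum-∷-long k c αs@(_ ∷ _) =
  cong (λ n → suc (suc n)) (cong sum (deltaGo-after-one (suc (suc c)) (suc c) αs))

deltaSum-∷-single : ∀ k n αs → deltaSum (k ∷ 1 ∷ n ∷ αs) ≡ suc (deltaSum (n ∷ αs))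
deltaSum-∷-single k n αs with gt1 k
deltaSum-∷-single k n []          | true  = refl
deltaSum-∷-single k n []          | false = refl
deltaSum-∷-single k n αs@(_ ∷ _) | true  with gt1 n
... | true  = refl
... | false = refl
deltaSum-∷-single k n αs@(_ ∷ _) | false with gt1 n
... | true  = refl
... | false = refl

deltaSum-∷-runsFrom-long : ∀ k y j w →
  deltaSum (k ∷ runsFrom y (suc (suc j)) w) ≡ suc (deltaSum (runsFrom y (suc j) w))
deltaSum-∷-runsFrom-long k y j []      = refl
deltaSum-∷-runsFrom-long k y j (z ∷ w) with y == z
... | true  = deltaSum-∷-runsFrom-long k y (suc j) w
... | false = deltaSum-∷-long k j (runsFrom z 1 w)

deltaSum-∷-1-∷-runsFrom : ∀ k y j w →
  deltaSum (k ∷ 1 ∷ runsFrom y j w) ≡ suc (deltaSum (runsFrom y j w))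
deltaSum-∷-1-∷-runsFrom k y j []      = deltaSum-∷-single k j []
deltaSum-∷-1-∷-runsFrom k y j (z ∷ w) with y == z
... | true  = deltaSum-∷-1-∷-runsFrom k y (suc j) w
... | false = deltaSum-∷-single k j (runsFrom z 1 w)

deltaSum-∷-runsFrom : ∀ k y w → deltaSum (k ∷ runsFrom y 1 w) ≡ suc (δ w)
deltaSum-∷-runsFrom k y []      = refl
deltaSum-∷-runsFrom k a (a ∷ w) = deltaSum-∷-runsFrom-long k a 0 w
deltaSum-∷-runsFrom k b (b ∷ w) = deltaSum-∷-runsFrom-long k b 0 w
deltaSum-∷-runsFrom k a (b ∷ w) = deltaSum-∷-1-∷-runsFrom k b 1 w
deltaSum-∷-runsFrom k b (a ∷ w) = deltaSum-∷-1-∷-runsFrom k a 1 w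

deltaSum-runsFrom-constant : ∀ x k w → allEq x w ≡ true → deltaSum (runsFrom x k w) ≡ 1
deltaSum-runsFrom-constant x k []      _ = refl
deltaSum-runsFrom-constant a k (a ∷ w) e = deltaSum-runsFrom-constant a (suc k) w e
deltaSum-runsFrom-constant b k (b ∷ w) e = deltaSum-runsFrom-constant b (suc k) w e
deltaSum-runsFrom-constant a k (b ∷ w) ()
deltaSum-runsFrom-constant b k (a ∷ w) ()

deltaSum-runsFrom-nonconstant : ∀ x k w → allEq x w ≡ false →
  deltaSum (runsFrom x k w) ≡ suc (δ (afterFirst (other x) w))
deltaSum-runsFrom-nonconstant x k []      ()
deltaSum-runsFrom-nonconstant a k (a ∷ w) e = deltaSum-runsFrom-nonconstant a (suc k) w e
deltaSum-runsFrom-nonconstant b k (b ∷ w) e = deltaSum-runsFrom-nonconstant b (suc k) w e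
deltaSum-runsFrom-nonconstant a k (b ∷ w) _ = deltaSum-∷-runsFrom k b w
deltaSum-runsFrom-nonconstant b k (a ∷ w) _ = deltaSum-∷-runsFrom k a w

length-afterFirst-≤ : ∀ y w → length (afterFirst y w) ≤ length w
length-afterFirst-≤ y []      = z≤n
length-afterFirst-≤ y (z ∷ w) with z == y
... | true  = n≤1+n (length w)
... | false = ≤-trans (length-afterFirst-≤ y w) (n≤1+n (length w))

heightF≡δ : ∀ fuel v → length v ≤ fuel → heightF fuel v ≡ δ v
heightF≡δ zero       []      _         = refl
heightF≡δ (suc fuel) []      _         = refl
heightF≡δ (suc fuel) (x ∷ w) (s≤s len≤) with allEq x w in constant
... | true  = sym (deltaSum-runsFrom-constant x 1 w constant)
... | false = trans (cong suc (heightF≡δ fuel (afterFirst (other x) w) plus-len≤))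
                    (sym (deltaSum-runsFrom-nonconstant x 1 w constant))
  where
  plus-len≤ : length (afterFirst (other x) w) ≤ fuel
  plus-len≤ = ≤-trans (length-afterFirst-≤ (other x) w) len≤

mainTheorem10 : (v : Word) → height v ≡ δ v
mainTheorem10 v = heightF≡δ (length v) v ≤-refl
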